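{- Let $\mathfrak{D} = \langle \mathfrak{M}, \star\rangle$ be a class of dynamic models. The following axiom schemata are valid in $\mathfrak{D}$ (for all $\varphi \in \mathcal{L}_0$ and $\xi \in \mathcal{L}_\leq(\star)$) iff $\star$ is $\mathfrak{M}$-DP1-compliant: $$ \begin{array}{lcl} {}[\star\varphi][\leq]\xi &\rightarrow& (\varphi \rightarrow [\leq](\varphi \rightarrow [\star\varphi] \xi))\\ {}[\star\varphi][<]\xi &\rightarrow& (\varphi \rightarrow [<](\varphi \rightarrow [\star\varphi] \xi))\\ {}[\leq][\star\varphi]\xi &\rightarrow& (\varphi \rightarrow [\star\varphi][\leq](\varphi \rightarrow \xi))\\ {}[<][\star\varphi]\xi &\rightarrow& (\varphi \rightarrow [\star\varphi][<](\varphi \rightarrow \xi)) \end{array}$$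
   Context: Fix a set $P$ of propositional letters; $\mathcal{L}_0$ is the classical propositional language over $P$. A (well-founded) preference model is $M=\langle W,\leq,v\rangle$ with $W$ a set of worlds, $\leq$ a reflexive, transitive relation on $W$ whose strict part $<$ is well-founded, and $v:P\to 2^W$ a valuation; $\mathit{Mod}(\mathcal{L}_\leq)$ is the class of all such models. A dynamic operator is a map $\star:\mathit{Mod}(\mathcal{L}_\leq)\times\mathcal{L}_0\to\mathit{Mod}(\mathcal{L}_\leq)$ with $\star(M,\varphi)=\langle W,\leq_{\star\varphi},v\rangle$ (same worlds and valuation). The language $\mathcal{L}_\leq(\star)$ is built from $P$ with $\neg,\wedge$, the universal modality $A$, the modalities $[\leq]$, $[<]$, and formulas $[\star\varphi]\xi$ with $\varphi\in\mathcal{L}_0$; $E,\langle\leq\rangle,\langle<\rangle$ are the duals. A dynamic model is $D=\langle M,\star\rangle$, with $D,w\vDash A\xi$ iff every world satisfies $\xi$, $D,w\vDash[\leq]\xi$ iff every $w'\leq w$ satisfies $\xi$, $D,w\vDash[<]\xi$ iff every $w'<w$ satisfies $\xi$, and $D,w\vDash[\star\varphi]\xi$ iff $\langle\star(M,\varphi),\star\rangle,w\vDash\xi$. For a class $\mathfrak{M}$ of preference models over which $\star$ is closed, $\mathfrak{D}=\langle\mathfrak{M},\star\rangle$ is the class of dynamic models $\langle M,\star\rangle$ with $M\in\mathfrak{M}$; a formula is valid in $\mathfrak{D}$ if it is true at every world of every such model. $[\![\varphi]\!]$ denotes the set of worlds of the model under consideration satisfying $\varphi$. $\star$ is $\mathfrak{M}$-DP1-compliant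 if for every $M=\langle W,\leq,v\rangle\in\mathfrak{M}$, every $\varphi\in\mathcal{L}_0$ and all $w,w'\in[\![\varphi]\!]$, with $D=\langle M,\star\rangle$: (DP1a) if $w\leq_{\star\varphi}w'$ ($w<_{\star\varphi}w'$) then for every $\xi\in\mathcal{L}_\leq(\star)$ with $D,w\vDash[\star\varphi]\xi$ there is $w''\in[\![\varphi]\!]$ with $D,w''\vDash[\star\varphi]\xi$ and $w''\leq w'$ ($w''<w'$); (DP1b) if $w\leq w'$ ($w<w'$) then for every $\xi\in\mathcal{L}_\leq(\star)$ with $D,w\vDash[\star\varphi]\xi$ there is $w''\in[\![\varphi]\!]$ with $D,w''\vDash[\star\varphi]\xi$ and $w''\leq_{\star\varphi}w'$ ($w''<_{\star\varphi}w'$). -}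

module Defs where

open import Level using (0ℓ)
open import Data.Product using (Σ; _×_; _,_)
open import Relation.Nullary using (¬_)
open import Induction.WellFounded using (WellFounded)

module _ (P : Set) where

  data L0 : Set where
    atom0 : P → L0
    neg0  : L0 → L0
    and0  : L0 → L0 → L0

  data Form : Set where
    atom   : P → Form
    neg    : Form → Form
    and    : Form → Form → Form
    univ   : Form → Form
    boxLe  : Form → Form
    boxLt  : Form → Form
    boxSt  : L0 → Form → Form

module _ {P : Set} where

  emb : L0 P → Form P
  emb (atom0 p)  = atom p
  emb (neg0 φ)   = neg (emb φ)
  emb (and0 φ ψ) = and (emb φ) (emb ψ)

  imp : Form P → Form P → Form P
  imp a b = neg (and a (neg b))

Strict : {W : Set} → (W → W → Set) → W → W → Set
Strict _≤_ x y = (x ≤ y) × ¬ (y ≤ x)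

record PrefOrder (W : Set) : Set₁ where
  field
    _≤_   : W → W → Set
    ≤-refl  : ∀ {x} → x ≤ x
    ≤-trans : ∀ {x y z} → x ≤ y → y ≤ z → x ≤ z
    <-wf    : WellFounded (Strict _≤_)

  _<_ : W → W → Set
  _<_ = Strict _≤_

record PrefModel (P : Set) : Set₁ where
  field
    W     : Set
    order : PrefOrder W
    v     : P → W → Set

  open PrefOrder order public

open PrefModel

-- A dynamic operator ⋆ : Mod(ℒ_≤) × ℒ₀ → Mod(ℒ_≤) keeping worlds and
-- valuation: it is given by the new preference order ≤_{⋆φ} on W.
Star : Set → Set₁
Star P = (M : PrefModel P) → L0 P → PrefOrder (W M)

update : {P : Set} → Star P → PrefModel P → L0 P → PrefModel P
update star M φ = record { W = W M ; order = star M φ ; v = v M }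

sat0 : {P : Set} (M : PrefModel P) → W M → L0 P → Set
sat0 M w (atom0 p)  = v M p w
sat0 M w (neg0 φ)   = ¬ sat0 M w φ
sat0 M w (and0 φ ψ) = sat0 M w φ × sat0 M w ψ

sat : {P : Set} (star : Star P) (M : PrefModel P) → W M → Form P → Set
sat star M w (atom p)    = v M p w
sat star M w (neg ξ)     = ¬ sat star M w ξ
sat star M w (and ξ ζ)   = sat star M w ξ × sat star M w ζ
sat star M w (univ ξ)    = ∀ w' → sat star M w' ξ
sat star M w (boxLe ξ)   = ∀ w' → _≤_ M w' w → sat star M w' ξ
sat star M w (boxLt ξ)   = ∀ w' → _<_ M w' w → sat star M w' ξ
sat star M w (boxSt φ ξ) = sat star (update star M φ) w ξ

ModelClass : Set → Set₂
ModelClass P = PrefModel P → Set₁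

ClosedUnder : {P : Set} → Star P → ModelClass P → Set₁
ClosedUnder star 𝔐 = ∀ M φ → 𝔐 M → 𝔐 (update star M φ)

Valid : {P : Set} → Star P → ModelClass P → Form P → Set₁
Valid star 𝔐 χ = ∀ M → 𝔐 M → ∀ (w : W M) → sat star M w χ

ax1 ax2 ax3 ax4 : {P : Set} → L0 P → Form P → Form P
ax1 φ ξ = imp (boxSt φ (boxLe ξ)) (imp (emb φ) (boxLe (imp (emb φ) (boxSt φ ξ))))
ax2 φ ξ = imp (boxSt φ (boxLt ξ)) (imp (emb φ) (boxLt (imp (emb φ) (boxSt φ ξ))))
ax3 φ ξ = imp (boxLe (boxSt φ ξ)) (imp (emb φ) (boxSt φ (boxLe (imp (emb φ) ξ))))
ax4 φ ξ = imp (boxLt (boxSt φ ξ)) (imp (emb φ) (boxSt φ (boxLt (imp (emb φ) ξ))))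

AxiomsValid : {P : Set} → Star P → ModelClass P → Set₁
AxiomsValid star 𝔐 = ∀ φ ξ →
  Valid star 𝔐 (ax1 φ ξ) × Valid star 𝔐 (ax2 φ ξ) ×
  Valid star 𝔐 (ax3 φ ξ) × Valid star 𝔐 (ax4 φ ξ)

DP1-compliant : {P : Set} → Star P → ModelClass P → Set₁
DP1-compliant {P} star 𝔐 =
  ∀ (M : PrefModel P) → 𝔐 M → ∀ (φ : L0 P) (w w' : W M) →
  sat0 M w φ → sat0 M w' φ →
  let M⋆ = update star M φ in
  (_≤_ M⋆ w w' → ∀ ξ → sat star M w (boxSt φ ξ) →
     Σ (W M) λ w'' → sat0 M w'' φ × sat star M w'' (boxSt φ ξ) × _≤_ M w'' w')
  ×
  (_<_ M⋆ w w' → ∀ ξ → sat star M w (boxSt φ ξ) →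
     Σ (W M) λ w'' → sat0 M w'' φ × sat star M w'' (boxSt φ ξ) × _<_ M w'' w')
  ×
  (_≤_ M w w' → ∀ ξ → sat star M w (boxSt φ ξ) →
     Σ (W M) λ w'' → sat0 M w'' φ × sat star M w'' (boxSt φ ξ) × _≤_ M⋆ w'' w')
  ×
  (_<_ M w w' → ∀ ξ → sat star M w (boxSt φ ξ) →
     Σ (W M) λ w'' → sat0 M w'' φ × sat star M w'' (boxSt φ ξ) × _<_ M⋆ w'' w')

-- Each schema corresponds to one clause of DP1 for a pair of relations R (the
-- one the hypothesis of the clause is about) and R' (the one the witness must
-- satisfy). DP1 applied to ¬ξ validates the schema for ξ: a φ-world R-below w
-- violating [⋆φ]ξ would have a φ-witness R'-below w violating it too. Conversely
-- the schema for φ → ¬ξ says, at w', that a missing witness forces every φ-world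
-- R-below w' to violate [⋆φ]ξ; excluded middle then turns the failure of this
-- conclusion into a witness.
module Submission where

open import Defs
open import Level using (0ℓ)
open import Axiom.ExcludedMiddle using (ExcludedMiddle)
open import Axiom.DoubleNegationElimination using (DoubleNegationElimination; em⇒dne)
open import Function.Base using (_∘_)
open import Function.Bundles using (_⇔_; mk⇔; Equivalence)
open import Function.Properties.Equivalence using (⇔-isEquivalence)
open import Data.Product using (Σ; _×_; _,_; proj₁; proj₂)
open import Relation.Binary.Structures using (IsEquivalence)
open import Relation.Binary.PropositionalEquality using (_≡_; refl; cong; cong₂; trans)
open import Relation.Nullary using (¬_)

open Equivalence using (to; from)

≡⇒⇔ : {A B : Set} → A ≡ B → A ⇔ B
≡⇒⇔ = IsEquivalence.reflexive ⇔-isEquivalence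

module FrameCorrespondence {W : Set} (R R' : W → W → Set) (Φ : W → Set) where

  -- Truth condition at w of  [R']T → (φ → [R](φ → T))  with implication read
  -- as ¬(a ∧ ¬b); E₀ and E are the extensions of φ outside and under [R].
  Schema : (E₀ E T : W → Set) → W → Set
  Schema E₀ E T w =
    ¬ ((∀ u → R' u w → T u) × ¬ ¬ (E₀ w × ¬ (∀ w' → R w' w → ¬ (E w' × ¬ T w'))))

  Witnessed : (T : W → Set) → W → W → Set
  Witnessed T w w' = R w w' → T w → Σ W λ u → Φ u × T u × R' u w'

  schema-valid : ∀ {E₀ E : W → Set} T → (∀ u → E₀ u ⇔ Φ u) → (∀ u → E u ⇔ Φ u) →
    (∀ {w w'} → Φ w → Φ w' → Witnessed (¬_ ∘ T) w w') → ∀ w → Schema E₀ E T w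
  schema-valid T E₀⇔Φ E⇔Φ witnessed w (□T , ¬¬conclusion) =
    ¬¬conclusion λ (e₀ , ¬□) → ¬□ λ w' r (e , ¬Tw') →
      let (u , _ , ¬Tu , r') = witnessed (to (E⇔Φ w') e) (to (E₀⇔Φ w) e₀) r ¬Tw'
      in ¬Tu (□T u r')

  witnessed-by-schema : DoubleNegationElimination 0ℓ → ∀ {E₀ E E⋆ : W → Set} T →
    (∀ u → E₀ u ⇔ Φ u) → (∀ u → E u ⇔ Φ u) → (∀ u → E⋆ u ⇔ Φ u) →
    ∀ {w w'} → Φ w → Φ w' → Schema E₀ E (λ u → ¬ (E⋆ u × T u)) w' → Witnessed T w w'
  witnessed-by-schema dne T E₀⇔Φ E⇔Φ E⋆⇔Φ {w} {w'} Φw Φw' schema r Tw = dne λ ¬witness →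
    schema
      ( (λ u r' (e⋆ , Tu) → ¬witness (u , to (E⋆⇔Φ u) e⋆ , Tu , r'))
      , λ k → k (from (E₀⇔Φ w') Φw' , λ □ → □ w r (from (E⇔Φ w) Φw , λ ¬T'w → ¬T'w (from (E⋆⇔Φ w) Φw , Tw))))

module _ {P : Set} (star : Star P) where

  open PrefModel
  open FrameCorrespondence

  sat0-update : ∀ M ψ u (φ : L0 P) → sat0 (update star M ψ) u φ ≡ sat0 M u φ
  sat0-update M ψ u (atom0 p)  = refl
  sat0-update M ψ u (neg0 φ)   = cong ¬_ (sat0-update M ψ u φ)
  sat0-update M ψ u (and0 φ χ) = cong₂ _×_ (sat0-update M ψ u φ) (sat0-update M ψ u χ)

  sat-emb : ∀ M u (φ : L0 P) → sat star M u (emb φ) ≡ sat0 M u φ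
  sat-emb M u (atom0 p)  = refl
  sat-emb M u (neg0 φ)   = cong ¬_ (sat-emb M u φ)
  sat-emb M u (and0 φ χ) = cong₂ _×_ (sat-emb M u φ) (sat-emb M u χ)

  module _ (M : PrefModel P) (φ : L0 P) where

    private
      M⋆ : PrefModel P
      M⋆ = update star M φ

    Φ : W M → Set
    Φ u = sat0 M u φ

    sat⋆ : Form P → W M → Set
    sat⋆ ξ u = sat star M⋆ u ξ

    emb-⇔ : ∀ u → sat star M u (emb φ) ⇔ Φ u
    emb-⇔ u = ≡⇒⇔ (sat-emb M u φ)

    emb⋆-⇔ : ∀ u → sat star M⋆ u (emb φ) ⇔ Φ u
    emb⋆-⇔ u = ≡⇒⇔ (trans (sat-emb M⋆ u φ) (sat0-update M φ u φ))

  module _ (𝔐 : ModelClass P) where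

    axioms-valid : DP1-compliant star 𝔐 → AxiomsValid star 𝔐
    axioms-valid dp φ ξ =
        (λ M M∈𝔐 → schema-valid (_≤_ M) (_≤_ (update star M φ)) (Φ M φ) (sat⋆ M φ ξ)
          (emb-⇔ M φ) (emb-⇔ M φ)
          λ Φw Φw' r → proj₁ (proj₂ (proj₂ (dp M M∈𝔐 φ _ _ Φw Φw'))) r (neg ξ))
      , (λ M M∈𝔐 → schema-valid (_<_ M) (_<_ (update star M φ)) (Φ M φ) (sat⋆ M φ ξ)
          (emb-⇔ M φ) (emb-⇔ M φ)
          λ Φw Φw' r → proj₂ (proj₂ (proj₂ (dp M M∈𝔐 φ _ _ Φw Φw'))) r (neg ξ))
      , (λ M M∈𝔐 → schema-valid (_≤_ (update star M φ)) (_≤_ M) (Φ M φ) (sat⋆ M φ ξ)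
          (emb-⇔ M φ) (emb⋆-⇔ M φ)
          λ Φw Φw' r → proj₁ (dp M M∈𝔐 φ _ _ Φw Φw') r (neg ξ))
      , (λ M M∈𝔐 → schema-valid (_<_ (update star M φ)) (_<_ M) (Φ M φ) (sat⋆ M φ ξ)
          (emb-⇔ M φ) (emb⋆-⇔ M φ)
          λ Φw Φw' r → proj₁ (proj₂ (dp M M∈𝔐 φ _ _ Φw Φw')) r (neg ξ))

    dp1-compliant : DoubleNegationElimination 0ℓ → AxiomsValid star 𝔐 → DP1-compliant star 𝔐
    dp1-compliant dne valid M M∈𝔐 φ w w' Φw Φw' =
        (λ r ξ → witnessed-by-schema (_≤_ M⋆) (_≤_ M) (Φ M φ) dne (sat⋆ M φ ξ)
                   (emb-⇔ M φ) (emb⋆-⇔ M φ) (emb⋆-⇔ M φ) Φw Φw'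
                   (proj₁ (proj₂ (proj₂ (valid φ (φ⇒¬ ξ)))) M M∈𝔐 w') r)
      , (λ r ξ → witnessed-by-schema (_<_ M⋆) (_<_ M) (Φ M φ) dne (sat⋆ M φ ξ)
                   (emb-⇔ M φ) (emb⋆-⇔ M φ) (emb⋆-⇔ M φ) Φw Φw'
                   (proj₂ (proj₂ (proj₂ (valid φ (φ⇒¬ ξ)))) M M∈𝔐 w') r)
      , (λ r ξ → witnessed-by-schema (_≤_ M) (_≤_ M⋆) (Φ M φ) dne (sat⋆ M φ ξ)
                   (emb-⇔ M φ) (emb-⇔ M φ) (emb⋆-⇔ M φ) Φw Φw'
                   (proj₁ (valid φ (φ⇒¬ ξ)) M M∈𝔐 w') r)
      , (λ r ξ → witnessed-by-schema (_<_ M) (_<_ M⋆) (Φ M φ) dne (sat⋆ M φ ξ)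
                   (emb-⇔ M φ) (emb-⇔ M φ) (emb⋆-⇔ M φ) Φw Φw'
                   (proj₁ (proj₂ (valid φ (φ⇒¬ ξ))) M M∈𝔐 w') r)
      where
      M⋆ : PrefModel P
      M⋆ = update star M φ
      φ⇒¬ : Form P → Form P
      φ⇒¬ ξ = neg (and (emb φ) ξ)

proposition26 : ExcludedMiddle 0ℓ →
    {P : Set} (star : Star P) (𝔐 : ModelClass P) → ClosedUnder star 𝔐 →
    AxiomsValid star 𝔐 ⇔ DP1-compliant star 𝔐
proposition26 em star 𝔐 _ = mk⇔ (dp1-compliant star 𝔐 (em⇒dne em)) (axioms-valid star 𝔐)
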